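{- Let $G=(X,E)$ be a finite connected undirected graph with real edge costs $\mathrm{cost}: E\to\mathbb{R}$, let $T$ be a minimum spanning tree of $G$, and let $I=\{e_1,\dots,e_n\}$ be a set of nontree edges of $T$. Let $T_{e_1,\dots,e_n}$ be the spanning tree obtained from $T$ by successively imposing $e_1,\dots,e_n$: set $T^0=T$, and for $m=1,\dots,n$ let $T^m$ be obtained from $T^{m-1}$ by removing $\text{r-edge}(T^{m-1},e_m)$ (computed with imposed set $\{e_1,\dots,e_{m-1}\}$, assumed to exist) and adding $e_m$; then $T_{e_1,\dots,e_n}=T^n$. Then for every edge $\{k,l\}\in E$ that is a nontree edge of both $T$ and $T_{e_1,\dots,e_n}$, $$\text{r-cost}(T_{e_1,\dots,e_n},\{k,l\}) \;\geq\; \text{r-cost}(T,\{k,l\}),$$ where the replacement cost in $T$ is computed with no imposed edges and the replacement cost in $T_{e_1,\dots,e_n}$ is computed with imposed set $I$.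
   Context: A spanning tree $S$ of $G$ is a tree with vertex set $X$ and edge set contained in $E$; its edges are tree edges and the edges of $E$ not in $S$ are nontree edges. A minimum spanning tree minimizes the sum of its edge costs. "Imposed" edges form a set $J\subseteq E$ of edges that must belong to the spanning tree. For a spanning tree $S$ with imposed set $J\subseteq S$ and a nontree edge $\{k,l\}$ of $S$, let $P(S,k,l)$ be the set of edges of the unique simple path from $k$ to $l$ in $S$. The replacement edge $\text{r-edge}(S,\{k,l\})$ is an edge of maximum cost among the edges of $P(S,k,l)$ that are not in $J$, and the replacement cost is $\text{r-cost}(S,\{k,l\})=\mathrm{cost}(\{k,l\})-\mathrm{cost}(\text{r-edge}(S,\{k,l\}))$. If every edge of $P(S,k,l)$ belongs to $J$ (no replacement edge exists), the replacement cost is defined to be $+\infty$.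
   Formalization: The edge costs take values in ℚ instead of ℝ, so the replacement costs lie in ℚ together with +∞. -}

module Defs where

open import Data.Nat using (ℕ)
open import Data.Fin using (Fin)
open import Data.Fin.Subset using (Subset; _∪_; ⁅_⁆; _-_) renaming (_∈_ to _∈ˢ_; _∉_ to _∉ˢ_)
open import Data.Fin.Subset.Properties using (_∈?_)
open import Data.Product using (_×_; _,_; proj₁; proj₂; ∃; ∃-syntax)
open import Data.Sum using (_⊎_)
open import Data.List using (List; []; _∷_; _++_; [_]; foldr; allFin)
open import Data.List.Membership.Propositional using (_∈_; _∉_)
open import Data.List.Relation.Unary.Unique.Propositional using (Unique)
open import Data.List.Relation.Unary.All using (All)
open import Data.Rational using (ℚ; 0ℚ; _+_; _≤_) renaming (_-_ to _-ℚ_)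
open import Relation.Nullary using (¬_; yes; no)
open import Relation.Binary.PropositionalEquality using (_≡_; _≢_)

data ℚ∞ : Set where
  fin : ℚ → ℚ∞
  ∞   : ℚ∞

data _≤∞_ : ℚ∞ → ℚ∞ → Set where
  fin≤fin : ∀ {x y} → x ≤ y → fin x ≤∞ fin y
  _≤∞∞    : ∀ x → x ≤∞ ∞

-- A finite simple undirected graph G = (X, E) with X = Fin n, E = Fin m.
-- Edge e has endpoints ends e (an unordered pair, stored as an ordered one).

record Graph : Set where
  field
    n     : ℕ
    m     : ℕ
    ends  : Fin m → Fin n × Fin n
    noLoop : ∀ e → proj₁ (ends e) ≢ proj₂ (ends e)
    simple : ∀ e f →
             (ends e ≡ ends f ⊎ (proj₁ (ends e) ≡ proj₂ (ends f) × proj₂ (ends e) ≡ proj₁ (ends f))) →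
             e ≡ f

module _ (G : Graph) where
  open Graph G

  Vertex : Set
  Vertex = Fin n

  Edge : Set
  Edge = Fin m

  Joins : Edge → Vertex → Vertex → Set
  Joins e u w = ends e ≡ (u , w) ⊎ ends e ≡ (w , u)

  data Walk (S : Subset m) : Vertex → Vertex → Set where
    nil  : ∀ {u} → Walk S u u
    cons : ∀ {u w v} (e : Edge) → e ∈ˢ S → Joins e u w → Walk S w v → Walk S u v

  verts : ∀ {S u v} → Walk S u v → List Vertex
  verts {u = u} nil = u ∷ []
  verts {u = u} (cons e _ _ p) = u ∷ verts p

  edgesOf : ∀ {S u v} → Walk S u v → List Edge
  edgesOf nil = []
  edgesOf (cons e _ _ p) = e ∷ edgesOf p

  IsPath : ∀ {S u v} → Walk S u v → Set
  IsPath p = Unique (verts p)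

  data Cycle (S : Subset m) : Set where
    cycle : ∀ {u w} (e : Edge) (h : e ∈ˢ S) (j : Joins e u w) (p : Walk S w u) →
            Unique (e ∷ edgesOf p) → Unique (verts p) → Cycle S

  Connected : Subset m → Set
  Connected S = ∀ (u v : Vertex) → Walk S u v

  AllEdges : Subset m
  AllEdges = Data.Fin.Subset.⊤
    where import Data.Fin.Subset

  record SpanningTree (S : Subset m) : Set where
    field
      connected : Connected S
      acyclic   : ¬ Cycle S

  module _ (cost : Edge → ℚ) where

    totalCost : Subset m → ℚ
    totalCost S = foldr (λ e acc → addIf e acc) 0ℚ (allFin m)
      where
      addIf : Edge → ℚ → ℚ
      addIf e acc with e ∈? S
      ... | yes _ = cost e + acc
      ... | no  _ = acc

    record MinimumSpanningTree (S : Subset m) : Set where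
      field
        isTree  : SpanningTree S
        minimal : ∀ S' → SpanningTree S' → totalCost S ≤ totalCost S'

    record REdge (S : Subset m) (J : List Edge) (e f : Edge) : Set where
      field
        nontree : e ∉ˢ S
        path    : Walk S (proj₁ (ends e)) (proj₂ (ends e))
        isPath  : IsPath path
        onPath  : f ∈ edgesOf path
        notImp  : f ∉ J
        maximal : ∀ g → g ∈ edgesOf path → g ∉ J → cost g ≤ cost f

    data RCost (S : Subset m) (J : List Edge) (e : Edge) : ℚ∞ → Set where
      viaREdge : ∀ f → REdge S J e f → RCost S J e (fin (cost e -ℚ cost f))
      noREdge  : e ∉ˢ S →
                 (p : Walk S (proj₁ (ends e)) (proj₂ (ends e))) → IsPath p →
                 All (_∈ J) (edgesOf p) → RCost S J e ∞

    data Imposes : List Edge → Subset m → List Edge → Subset m → Set where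
      done : ∀ {J S} → Imposes J S [] S
      step : ∀ {J S e es S'} (f : Edge) → REdge S J e f →
             Imposes (J ++ [ e ]) ((S - f) ∪ ⁅ e ⁆) es S' →
             Imposes J S (e ∷ es) S'

{-# OPTIONS --safe #-}
-- Let c be the cost of the r-edge of T for kl = {k, l}. Every imposing step, which turns the edge
-- set S into (S - f) ∪ ⁅ e ⁆ and the imposed list J into J ++ [ e ], preserves two invariants:
--  (1) some k–l walk in S uses only edges of cost ≤ c or in J: where it uses f (so cost f ≤ c),
--      reroute it around f along the cycle formed by e and its path in S;
--  (2) every non-imposed edge g of S is a bridge, witnessed by a 2-colouring of the vertices under
--      which g is the only edge of S with differently coloured ends: g keeps its colouring if it is
--      off the path of e, and otherwise takes its pointwise xor with the colouring for f.
-- A walk changes colour exactly at the occurrences of g, so by (2) g lies on every walk joining the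
-- ends of a path through g. The r-edge f₁ of Tₑ is not imposed and lies on the k–l path of Tₑ, hence
-- on the walk of (1), so cost f₁ ≤ c.
module Submission where

open import Defs
open import Data.Fin.Subset using (Subset) renaming (_∉_ to _∉ˢ_)
open import Data.List using (List; [])
open import Data.List.Relation.Unary.Unique.Propositional using (Unique)
open import Data.List.Relation.Unary.All using (All)
open import Data.Rational using (ℚ)

open import Algebra.Bundles using (CommutativeRing)
open import Data.Bool using (Bool; true; false; _xor_)
open import Data.Bool.Properties
  using (xor-assoc; xor-comm; xor-same; xor-identityʳ; xor-∧-commutativeRing)
open import Algebra.Properties.CommutativeSemigroup
  (CommutativeRing.+-commutativeSemigroup xor-∧-commutativeRing) using (interchange)
open import Data.Empty using (⊥-elim)
open import Data.Fin using (_≟_)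
open import Data.Fin.Subset
  using (_∪_; ⁅_⁆; _-_; _─_; inside; outside) renaming (_∈_ to _∈ˢ_)
open import Data.Fin.Subset.Properties
  using (p─q⊆p; x∈⁅x⁆; x∈⁅y⁆⇒x≡y; x∈p∪q⁺; x∈p∪q⁻; x∈p∧x≢y⇒x∈p-y)
open import Data.List using (_∷_; _++_; [_])
open import Data.List.Properties using (++-assoc; ++-identityʳ)
open import Data.List.Membership.Propositional using (_∈_; _∉_)
open import Data.List.Membership.Propositional.Properties using (∈-++⁺ˡ; ∈-++⁺ʳ)
open import Data.List.Relation.Unary.All using ([]; _∷_)
import Data.List.Relation.Unary.All as All
open import Data.List.Relation.Unary.All.Properties using (¬Any⇒All¬; ++⁻)
open import Data.List.Relation.Unary.AllPairs using ([]; _∷_)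
open import Data.List.Relation.Unary.Any using (here; there; any?)
open import Data.Product using (Σ; _×_; _,_; proj₁; proj₂)
open import Data.Product.Properties using (,-injective)
import Data.Product as Product
open import Data.Sum using (_⊎_; inj₁; inj₂; [_,_]′; swap)
import Data.Sum as Sum
open import Data.Vec using (_∷_; here; there)
open import Data.Rational using (_≤_)
import Data.Rational.Properties as ℚₚ
open import Function using (id; _∘_)
open import Relation.Nullary using (¬_; yes; no; does; contradiction)
open import Relation.Nullary.Decidable using (dec-true; dec-false)
open import Relation.Binary.Definitions using (DecidableEquality)
open import Relation.Binary.PropositionalEquality
  using (_≡_; _≢_; refl; sym; trans; cong; cong₂; subst; ≢-sym; module ≡-Reasoning)
open ≡-Reasoning

x∈p─q⇒x∉q : ∀ {n} (p q : Subset n) {x} → x ∈ˢ p ─ q → x ∉ˢ q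
x∈p─q⇒x∉q (inside ∷ p) (outside ∷ q) here      ()
x∈p─q⇒x∉q (_      ∷ p) (_       ∷ q) (there i) (there j) = x∈p─q⇒x∉q p q i j

x∈p-y⇒x≢y : ∀ {n} {p : Subset n} {x y} → x ∈ˢ p - y → x ≢ y
x∈p-y⇒x≢y {p = p} {y = y} x∈p-y refl = x∈p─q⇒x∉q p ⁅ y ⁆ x∈p-y (x∈⁅x⁆ y)

xor-cancel-middle : ∀ a b c → (a xor b) xor (b xor c) ≡ a xor c
xor-cancel-middle a b c = begin
  (a xor b) xor (b xor c)  ≡⟨ xor-assoc a b (b xor c) ⟩
  a xor (b xor (b xor c))  ≡⟨ cong (a xor_) (xor-assoc b b c) ⟨
  a xor ((b xor b) xor c)  ≡⟨ cong (λ z → a xor (z xor c)) (xor-same b) ⟩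
  a xor c                  ∎

module Parity {A : Set} (_≟ᴬ_ : DecidableEquality A) where

  parity : A → List A → Bool
  parity x []       = false
  parity x (y ∷ ys) = does (y ≟ᴬ x) xor parity x ys

  parity-∉ : ∀ {x xs} → x ∉ xs → parity x xs ≡ false
  parity-∉ {xs = []}     _   = refl
  parity-∉ {x} {y ∷ ys} x∉ rewrite dec-false (y ≟ᴬ x) (x∉ ∘ here ∘ sym) = parity-∉ (x∉ ∘ there)

  parity-∈ : ∀ {x xs} → Unique xs → x ∈ xs → parity x xs ≡ true
  parity-∈ {x} {y ∷ ys} (y∉ys ∷ _) (here refl)
    rewrite dec-true (x ≟ᴬ x) refl | parity-∉ (λ x∈ys → All.lookup y∉ys x∈ys refl) = refl
  parity-∈ {x} {y ∷ ys} (y∉ys ∷ U) (there x∈ys)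
    rewrite dec-false (y ≟ᴬ x) (All.lookup y∉ys x∈ys) = parity-∈ U x∈ys

module Walks (G : Graph) where
  open Graph G using (m; ends)

  private
    variable
      S S′ : Subset m
      P : Edge G → Set
      e g h : Edge G
      u v x y : Vertex G

  end₁ end₂ : Edge G → Vertex G
  end₁ e = proj₁ (ends e)
  end₂ e = proj₂ (ends e)

  joins-unique : Joins G e u v → Joins G e x y → (u ≡ x × v ≡ y) ⊎ (u ≡ y × v ≡ x)
  joins-unique (inj₁ p) (inj₁ q) = inj₁ (,-injective (trans (sym p) q))
  joins-unique (inj₁ p) (inj₂ q) = inj₂ (,-injective (trans (sym p) q))
  joins-unique (inj₂ p) (inj₁ q) = inj₂ (Product.swap (,-injective (trans (sym p) q)))
  joins-unique (inj₂ p) (inj₂ q) = inj₁ (Product.swap (,-injective (trans (sym p) q)))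

  _++ʷ_ : Walk G S u v → Walk G S v x → Walk G S u x
  nil            ++ʷ q = q
  cons e e∈S j p ++ʷ q = cons e e∈S j (p ++ʷ q)

  reverse : Walk G S u v → Walk G S v u
  reverse nil              = nil
  reverse (cons e e∈S j p) = reverse p ++ʷ cons e e∈S (swap j) nil

  All-++ʷ⁺ : (p : Walk G S u v) {q : Walk G S v x} →
             All P (edgesOf G p) → All P (edgesOf G q) → All P (edgesOf G (p ++ʷ q))
  All-++ʷ⁺ nil            []      B = B
  All-++ʷ⁺ (cons _ _ _ p) (a ∷ A) B = a ∷ All-++ʷ⁺ p A B

  All-reverse⁺ : (p : Walk G S u v) → All P (edgesOf G p) → All P (edgesOf G (reverse p))
  All-reverse⁺ nil            []      = []
  All-reverse⁺ (cons _ _ _ p) (a ∷ A) = All-++ʷ⁺ (reverse p) (All-reverse⁺ p A) (a ∷ [])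

  edgesOf-⊆ : (p : Walk G S u v) → All (_∈ˢ S) (edgesOf G p)
  edgesOf-⊆ nil              = []
  edgesOf-⊆ (cons _ e∈S _ p) = e∈S ∷ edgesOf-⊆ p

  retarget : (p : Walk G S u v) → All (_∈ˢ S′) (edgesOf G p) → Walk G S′ u v
  retarget nil            []          = nil
  retarget (cons e _ j p) (e∈S′ ∷ A) = cons e e∈S′ j (retarget p A)

  edgesOf-retarget : (p : Walk G S u v) (A : All (_∈ˢ S′) (edgesOf G p)) →
                     edgesOf G (retarget p A) ≡ edgesOf G p
  edgesOf-retarget nil            []      = refl
  edgesOf-retarget (cons e _ _ p) (_ ∷ A) = cong (e ∷_) (edgesOf-retarget p A)

  verts-retarget : (p : Walk G S u v) (A : All (_∈ˢ S′) (edgesOf G p)) →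
                   verts G (retarget p A) ≡ verts G p
  verts-retarget nil            []      = refl
  verts-retarget {u = u} (cons _ _ _ p) (_ ∷ A) = cong (u ∷_) (verts-retarget p A)

  WalkAll : Subset m → (Edge G → Set) → Vertex G → Vertex G → Set
  WalkAll S P u v = Σ (Walk G S u v) λ p → All P (edgesOf G p)

  _++ᵃ_ : WalkAll S P u v → WalkAll S P v x → WalkAll S P u x
  (p , A) ++ᵃ (q , B) = p ++ʷ q , All-++ʷ⁺ p A B

  reverseᵃ : WalkAll S P u v → WalkAll S P v u
  reverseᵃ (p , A) = reverse p , All-reverse⁺ p A

  edgeless⇒≡ : (p : Walk G S u v) → All (_∈ []) (edgesOf G p) → u ≡ v
  edgeless⇒≡ nil            []       = refl
  edgeless⇒≡ (cons _ _ _ _) (() ∷ _)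

  head∈verts : (p : Walk G S u v) → u ∈ verts G p
  head∈verts nil            = here refl
  head∈verts (cons _ _ _ _) = here refl

  endpoint∈verts : (p : Walk G S u v) → h ∈ edgesOf G p → Joins G h x y → x ∈ verts G p
  endpoint∈verts (cons _ _ j p) (here refl) j′ with joins-unique j′ j
  ... | inj₁ (refl , _) = here refl
  ... | inj₂ (refl , _) = there (head∈verts p)
  endpoint∈verts (cons _ _ _ p) (there i) j′ = there (endpoint∈verts p i j′)

  IsPath⇒Unique-edgesOf : (p : Walk G S u v) → IsPath G p → Unique (edgesOf G p)
  IsPath⇒Unique-edgesOf nil            _           = []
  IsPath⇒Unique-edgesOf (cons e _ j p) (u∉p ∷ U) = All.tabulate e≢ ∷ IsPath⇒Unique-edgesOf p U
    where
    e≢ : ∀ {h} → h ∈ edgesOf G p → e ≢ h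
    e≢ i refl = All.lookup u∉p (endpoint∈verts p i j) refl

  suffixFrom : (p : Walk G S u v) → IsPath G p → x ∈ verts G p → Σ (Walk G S x v) (IsPath G)
  suffixFrom nil                  U       (here refl) = nil , U
  suffixFrom (cons e e∈S j p)     U       (here refl) = cons e e∈S j p , U
  suffixFrom (cons _ _ _ p)       (_ ∷ U) (there i)   = suffixFrom p U i

  toPath : Walk G S u v → Σ (Walk G S u v) (IsPath G)
  toPath nil = nil , [] ∷ []
  toPath {u = u} (cons e e∈S j p) with toPath p
  ... | q , Q with any? (u ≟_) (verts G q)
  ...   | yes u∈q = suffixFrom q Q u∈q
  ...   | no  u∉q = cons e e∈S j q , ¬Any⇒All¬ (verts G q) u∉q ∷ Q

  record Split {S : Subset m} {u v : Vertex G} (p : Walk G S u v) (g : Edge G) : Set where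
    field
      a b           : Vertex G
      before        : Walk G S u a
      joins         : Joins G g a b
      after         : Walk G S b v
      edgesOf-split : edgesOf G p ≡ edgesOf G before ++ g ∷ edgesOf G after
      g∉before      : g ∉ edgesOf G before
      g∉after       : g ∉ edgesOf G after

  split : (p : Walk G S u v) → Unique (edgesOf G p) → g ∈ edgesOf G p → Split p g
  split (cons e e∈S j p) (e∉p ∷ _) (here refl) = record
    { a = _ ; b = _ ; before = nil ; joins = j ; after = p ; edgesOf-split = refl
    ; g∉before = λ () ; g∉after = λ e∈p → All.lookup e∉p e∈p refl }
  split (cons e e∈S j p) (e∉p ∷ U) (there g∈p) = record
    { a = a ; b = b ; before = cons e e∈S j before ; joins = joins ; after = after
    ; edgesOf-split = cong (e ∷_) edgesOf-split
    ; g∉before = λ { (here refl) → All.lookup e∉p g∈p refl ; (there i) → g∉before i }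
    ; g∉after = g∉after }
    where open Split (split p U g∈p)

module Cuts (G : Graph) where
  open Graph G using (m)
  open Parity (_≟_ {m})
  open Walks G

  private
    variable
      S T : Subset m
      g h : Edge G
      u v : Vertex G
      κ : Vertex G → Bool

  crossing : (Vertex G → Bool) → Edge G → Bool
  crossing κ h = κ (end₁ h) xor κ (end₂ h)

  _⊕_ : (Vertex G → Bool) → (Vertex G → Bool) → Vertex G → Bool
  (κ ⊕ κ′) v = κ v xor κ′ v

  crossing-⊕ : ∀ κ κ′ h → crossing (κ ⊕ κ′) h ≡ crossing κ h xor crossing κ′ h
  crossing-⊕ κ κ′ h = interchange (κ (end₁ h)) (κ′ (end₁ h)) (κ (end₂ h)) (κ′ (end₂ h))

  crossing-joins : ∀ κ → Joins G h u v → crossing κ h ≡ κ u xor κ v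
  crossing-joins κ (inj₁ eq) rewrite eq = refl
  crossing-joins {u = u} {v} κ (inj₂ eq) rewrite eq = xor-comm (κ v) (κ u)

  record IsCut (S : Subset m) (g : Edge G) (κ : Vertex G → Bool) : Set where
    constructor isCut
    field
      crossing≡ : ∀ h → h ∈ˢ S → crossing κ h ≡ does (h ≟ g)

  IsCut⇒xor-ends : IsCut S g κ → (p : Walk G S u v) → κ u xor κ v ≡ parity g (edgesOf G p)
  IsCut⇒xor-ends {κ = κ} cut nil = xor-same (κ _)
  IsCut⇒xor-ends {g = g} {κ} {u} {v} cut (cons {w = w} h h∈S j p) = begin
    κ u xor κ v                      ≡⟨ xor-cancel-middle (κ u) (κ w) (κ v) ⟨
    (κ u xor κ w) xor (κ w xor κ v)  ≡⟨ cong₂ _xor_ (trans (sym (crossing-joins κ j))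
                                                           (IsCut.crossing≡ cut h h∈S))
                                                    (IsCut⇒xor-ends cut p) ⟩
    does (h ≟ g) xor parity g (edgesOf G p)  ∎

  cut-edge-unavoidable : IsCut S g κ → (p : Walk G S u v) → Unique (edgesOf G p) →
                         g ∈ edgesOf G p → (q : Walk G S u v) → g ∈ edgesOf G q
  cut-edge-unavoidable {g = g} {κ} {u} {v} cut p U g∈p q with any? (g ≟_) (edgesOf G q)
  ... | yes g∈q = g∈q
  ... | no  g∉q = contradiction parity-clash λ ()
    where
    parity-clash : true ≡ false
    parity-clash = begin
      true                     ≡⟨ parity-∈ U g∈p ⟨
      parity g (edgesOf G p)   ≡⟨ IsCut⇒xor-ends cut p ⟨
      κ u xor κ v              ≡⟨ IsCut⇒xor-ends cut q ⟩
      parity g (edgesOf G q)   ≡⟨ parity-∉ g∉q ⟩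
      false                    ∎

  BridgeCuts : List (Edge G) → Subset m → Set
  BridgeCuts J S = ∀ g → g ∈ˢ S → g ∉ J → Σ (Vertex G → Bool) (IsCut S g)

  module FundamentalCut (tree : SpanningTree G T) {g : Edge G} (g∈T : g ∈ˢ T) where
    open SpanningTree tree

    end : Bool → Vertex G
    end false = end₁ g
    end true  = end₂ g

    -- a walk around g, shortened to a path, would close a cycle with g
    no-bypass : ¬ Walk G (T - g) (end₁ g) (end₂ g)
    no-bypass p = acyclic (cycle g g∈T (inj₁ refl) q (g∉q ∷ IsPath⇒Unique-edgesOf q q-path) q-path)
      where
      r : Walk G (T - g) (end₂ g) (end₁ g)
      r = proj₁ (toPath (reverse p))
      r∈T : All (_∈ˢ T) (edgesOf G r)
      r∈T = All.map (p─q⊆p T ⁅ g ⁆) (edgesOf-⊆ r)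
      q : Walk G T (end₂ g) (end₁ g)
      q = retarget r r∈T
      q-path : IsPath G q
      q-path = subst Unique (sym (verts-retarget r r∈T)) (proj₂ (toPath (reverse p)))
      g∉q : All (g ≢_) (edgesOf G q)
      g∉q = subst (All (g ≢_)) (sym (edgesOf-retarget r r∈T))
                  (All.map (≢-sym ∘ x∈p-y⇒x≢y) (edgesOf-⊆ r))

    same-side : ∀ s t → Walk G (T - g) (end s) (end t) → s ≡ t
    same-side false false _ = refl
    same-side true  true  _ = refl
    same-side false true  p = ⊥-elim (no-bypass p)
    same-side true  false p = ⊥-elim (no-bypass (reverse p))

    Side : Vertex G → Set
    Side v = Σ Bool λ s → Walk G (T - g) (end s) v

    side-after-g : Joins G g u v → Side v
    side-after-g (inj₁ eq) = true  , subst (Walk G (T - g) (end₂ g)) (cong proj₂ eq) nil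
    side-after-g (inj₂ eq) = false , subst (Walk G (T - g) (end₁ g)) (cong proj₁ eq) nil

    extend-side : Walk G T u v → Side u → Side v
    extend-side nil σ = σ
    extend-side (cons h h∈T j p) (s , q) with h ≟ g
    ... | yes refl = extend-side p (side-after-g j)
    ... | no  h≢g  = extend-side p (s , q ++ʷ cons h (x∈p∧x≢y⇒x∈p-y h∈T h≢g) j nil)

    side : ∀ v → Side v
    side v = extend-side (connected (end₁ g) v) (false , nil)

    colour : Vertex G → Bool
    colour v = proj₁ (side v)

    crossing-colour : ∀ h → h ∈ˢ T → crossing colour h ≡ does (h ≟ g)
    crossing-colour h h∈T with side (end₁ h) | side (end₂ h) | h ≟ g
    ... | s₁ , p₁ | s₂ , p₂ | yes refl = cong₂ _xor_ (same-side s₁ false p₁) (same-side s₂ true p₂)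
    ... | s₁ , p₁ | s₂ , p₂ | no  h≢g  =
      trans (cong (_xor s₂) (same-side s₁ s₂ (p₁ ++ʷ cons h h∈T-g (inj₁ refl) (reverse p₂))))
            (xor-same s₂)
      where
      h∈T-g : h ∈ˢ T - g
      h∈T-g = x∈p∧x≢y⇒x∈p-y h∈T h≢g

  SpanningTree⇒BridgeCuts : ∀ {J} → SpanningTree G T → BridgeCuts J T
  SpanningTree⇒BridgeCuts tree g g∈T _ = colour , isCut crossing-colour
    where open FundamentalCut tree g∈T

module _ (G : Graph) (cost : Edge G → ℚ) where
  open Graph G using (m)
  open Parity (_≟_ {m})
  open Walks G
  open Cuts G

  private
    variable
      J : List (Edge G)
      S Sₑ : Subset m
      h : Edge G
      u v : Vertex G

  module _ (c : ℚ) where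

    CheapOrImposed : List (Edge G) → Edge G → Set
    CheapOrImposed J h = cost h ≤ c ⊎ h ∈ J

    CheapOrImposed-++⁺ : ∀ J′ → CheapOrImposed J h → CheapOrImposed (J ++ J′) h
    CheapOrImposed-++⁺ _ = Sum.map₂ ∈-++⁺ˡ

    REdge⇒path-cheap : ∀ {S e f} (r : REdge G cost S J e f) → cost f ≤ c →
                       All (CheapOrImposed J) (edgesOf G (REdge.path r))
    REdge⇒path-cheap {J} {f = f} r cf = All.tabulate cheap
      where
      open REdge r
      cheap : h ∈ edgesOf G path → CheapOrImposed J h
      cheap {h} h∈path with any? (h ≟_) J
      ... | yes h∈J = inj₂ h∈J
      ... | no  h∉J = inj₁ (ℚₚ.≤-trans (maximal h h∈path h∉J) cf)

    module Swap {J S e f} (r : REdge G cost S J e f) where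
      open REdge r

      J′ : List (Edge G)
      J′ = J ++ [ e ]

      S′ : Subset m
      S′ = (S - f) ∪ ⁅ e ⁆

      ∈S′⁺ : h ∈ˢ S → h ≢ f → h ∈ˢ S′
      ∈S′⁺ h∈S h≢f = x∈p∪q⁺ (inj₁ (x∈p∧x≢y⇒x∈p-y h∈S h≢f))

      e∈S′ : e ∈ˢ S′
      e∈S′ = x∈p∪q⁺ (inj₂ (x∈⁅x⁆ e))

      ∈S′⁻ : h ∈ˢ S′ → (h ∈ˢ S × h ≢ f) ⊎ h ≡ e
      ∈S′⁻ h∈S′ = Sum.map (λ h∈S-f → p─q⊆p S ⁅ f ⁆ h∈S-f , x∈p-y⇒x≢y h∈S-f) (x∈⁅y⁆⇒x≡y e)
                          (x∈p∪q⁻ (S - f) ⁅ e ⁆ h∈S′)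

      e∈J′ : e ∈ J′
      e∈J′ = ∈-++⁺ʳ J (here refl)

      ∉J′⇒e≢ : ∀ {g} → g ∉ J′ → e ≢ g
      ∉J′⇒e≢ g∉J′ refl = g∉J′ e∈J′

      f∈S : f ∈ˢ S
      f∈S = All.lookup (edgesOf-⊆ path) onPath

      path-unique : Unique (edgesOf G path)
      path-unique = IsPath⇒Unique-edgesOf path isPath

      open Split (split path path-unique onPath)

      toS′ : (p : Walk G S u v) → f ∉ edgesOf G p → All (CheapOrImposed J′) (edgesOf G p) →
             WalkAll S′ (CheapOrImposed J′) u v
      toS′ p f∉p cheap = retarget p p∈S′ , subst (All _) (sym (edgesOf-retarget p p∈S′)) cheap
        where
        p∈S′ : All (_∈ˢ S′) (edgesOf G p)
        p∈S′ = All.tabulate λ h∈p →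
          ∈S′⁺ (All.lookup (edgesOf-⊆ p) h∈p) λ { refl → f∉p h∈p }

      -- apart from e, now imposed, its edges lie on the path of e, so are imposed or no dearer than f
      detour : cost f ≤ c → WalkAll S′ (CheapOrImposed J′) a b
      detour cf = reverseᵃ (toS′ before g∉before before-cheap)
               ++ᵃ ((cons e e∈S′ (inj₁ refl) nil , inj₂ e∈J′ ∷ [])
               ++ᵃ reverseᵃ (toS′ after g∉after after-cheap))
        where
        split-cheap : All (CheapOrImposed J′) (edgesOf G before) ×
                      All (CheapOrImposed J′) (f ∷ edgesOf G after)
        split-cheap = ++⁻ (edgesOf G before)
          (subst (All _) edgesOf-split (All.map (CheapOrImposed-++⁺ [ e ]) (REdge⇒path-cheap r cf)))
        before-cheap : All (CheapOrImposed J′) (edgesOf G before)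
        before-cheap = proj₁ split-cheap
        after-cheap : All (CheapOrImposed J′) (edgesOf G after)
        after-cheap = All.tail (proj₂ split-cheap)

      bypass : cost f ≤ c → Joins G f u v → WalkAll S′ (CheapOrImposed J′) u v
      bypass cf j with joins-unique joins j
      ... | inj₁ (refl , refl) = detour cf
      ... | inj₂ (refl , refl) = reverseᵃ (detour cf)

      cheapWalk-swap : (p : Walk G S u v) → All (CheapOrImposed J) (edgesOf G p) →
                       WalkAll S′ (CheapOrImposed J′) u v
      cheapWalk-swap nil [] = nil , []
      cheapWalk-swap (cons h h∈S j p) (h-cheap ∷ p-cheap) with h ≟ f
      ... | yes refl = bypass ([ id , ⊥-elim ∘ notImp ]′ h-cheap) j ++ᵃ cheapWalk-swap p p-cheap
      ... | no  h≢f  = (cons h (∈S′⁺ h∈S h≢f) j nil , CheapOrImposed-++⁺ [ e ] h-cheap ∷ [])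
                       ++ᵃ cheapWalk-swap p p-cheap

      IsCut-swap : ∀ {g κ} → (∀ h → h ∈ˢ S → h ≢ f → crossing κ h ≡ does (h ≟ g)) →
                   crossing κ e ≡ does (e ≟ g) → IsCut S′ g κ
      IsCut-swap old new = isCut λ h h∈S′ →
        [ (λ (h∈S , h≢f) → old h h∈S h≢f) , (λ { refl → new }) ]′ (∈S′⁻ h∈S′)

      cut-off-path : ∀ {g κ} → IsCut S g κ → g ∉ edgesOf G path → e ≢ g → IsCut S′ g κ
      cut-off-path {g} {κ} cut g∉path e≢g = IsCut-swap (λ h h∈S _ → IsCut.crossing≡ cut h h∈S) new
        where
        new : crossing κ e ≡ does (e ≟ g)
        new = begin
          crossing κ e               ≡⟨ IsCut⇒xor-ends cut path ⟩
          parity g (edgesOf G path)  ≡⟨ parity-∉ g∉path ⟩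
          false                      ≡⟨ dec-false (e ≟ g) e≢g ⟨
          does (e ≟ g)               ∎

      -- the path of e runs once through g and once through f, so e crosses both cuts and hence not
      -- their sum; f, the only edge of S crossing the cut of f, is gone
      cut-on-path : ∀ {g κ κ′} → IsCut S g κ → IsCut S f κ′ → g ∈ edgesOf G path → e ≢ g →
                    IsCut S′ g (κ ⊕ κ′)
      cut-on-path {g} {κ} {κ′} cut cut′ g∈path e≢g = IsCut-swap old new
        where
        old : ∀ h → h ∈ˢ S → h ≢ f → crossing (κ ⊕ κ′) h ≡ does (h ≟ g)
        old h h∈S h≢f = begin
          crossing (κ ⊕ κ′) h             ≡⟨ crossing-⊕ κ κ′ h ⟩
          crossing κ h xor crossing κ′ h  ≡⟨ cong₂ _xor_ (IsCut.crossing≡ cut h h∈S)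
                                                          (IsCut.crossing≡ cut′ h h∈S) ⟩
          does (h ≟ g) xor does (h ≟ f)   ≡⟨ cong (does (h ≟ g) xor_) (dec-false (h ≟ f) h≢f) ⟩
          does (h ≟ g) xor false          ≡⟨ xor-identityʳ _ ⟩
          does (h ≟ g)                    ∎
        new : crossing (κ ⊕ κ′) e ≡ does (e ≟ g)
        new = begin
          crossing (κ ⊕ κ′) e             ≡⟨ crossing-⊕ κ κ′ e ⟩
          crossing κ e xor crossing κ′ e  ≡⟨ cong₂ _xor_ (IsCut⇒xor-ends cut path)
                                                          (IsCut⇒xor-ends cut′ path) ⟩
          parity g (edgesOf G path) xor parity f (edgesOf G path)
                                          ≡⟨ cong₂ _xor_ (parity-∈ path-unique g∈path)
                                                          (parity-∈ path-unique onPath) ⟩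
          false                           ≡⟨ dec-false (e ≟ g) e≢g ⟨
          does (e ≟ g)                    ∎

      bridgeCuts-swap : BridgeCuts J S → BridgeCuts J′ S′
      bridgeCuts-swap cuts g g∈S′ g∉J′ with ∈S′⁻ g∈S′
      ... | inj₂ refl = ⊥-elim (∉J′⇒e≢ g∉J′ refl)
      ... | inj₁ (g∈S , _)
            with cuts g g∈S (g∉J′ ∘ ∈-++⁺ˡ) | cuts f f∈S notImp | any? (g ≟_) (edgesOf G path)
      ...   | κ , cut | _ , _     | no  g∉path = κ      , cut-off-path cut g∉path (∉J′⇒e≢ g∉J′)
      ...   | κ , cut | κ′ , cut′ | yes g∈path = κ ⊕ κ′ , cut-on-path cut cut′ g∈path
                                                                         (∉J′⇒e≢ g∉J′)

    Invariant : List (Edge G) → Subset m → Vertex G → Vertex G → Set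
    Invariant J S u v = WalkAll S (CheapOrImposed J) u v × BridgeCuts J S

    Imposes⇒Invariant : ∀ {es} → Imposes G cost J S es Sₑ →
                        Invariant J S u v → Invariant (J ++ es) Sₑ u v
    Imposes⇒Invariant {J} {S} {u = u} {v} done inv =
      subst (λ J′ → Invariant J′ S u v) (sym (++-identityʳ J)) inv
    Imposes⇒Invariant {J} {Sₑ = Sₑ} {u} {v} (step {e = e} {es} f r rest) ((walk , cheap) , cuts) =
      subst (λ J′ → Invariant J′ Sₑ u v) (++-assoc J [ e ] es)
        (Imposes⇒Invariant rest (cheapWalk-swap walk cheap , bridgeCuts-swap cuts))
      where open Swap r

  Imposes⇒r-edge-cost-≤ : ∀ {T Tₑ es e f₀ f₁} → SpanningTree G T → REdge G cost T [] e f₀ →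
                           Imposes G cost [] T es Tₑ → REdge G cost Tₑ es e f₁ → cost f₁ ≤ cost f₀
  Imposes⇒r-edge-cost-≤ {f₀ = f₀} {f₁} tree r₀ imposes r₁
    with Imposes⇒Invariant (cost f₀) imposes
           ((REdge.path r₀ , REdge⇒path-cheap (cost f₀) r₀ ℚₚ.≤-refl) ,
            SpanningTree⇒BridgeCuts tree)
  ... | (walk , cheap) , cuts = [ id , ⊥-elim ∘ notImp ]′ (All.lookup cheap f₁∈walk)
    where
    open REdge r₁
    f₁∈walk : f₁ ∈ edgesOf G walk
    f₁∈walk = cut-edge-unavoidable (proj₂ (cuts f₁ (All.lookup (edgesOf-⊆ path) onPath) notImp))
                path (IsPath⇒Unique-edgesOf path isPath) onPath walk

proposition3 : (G : Graph) (cost : Edge G → ℚ) →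
    Connected G (AllEdges G) →
    (T : Subset (Graph.m G)) → MinimumSpanningTree G cost T →
    (es : List (Edge G)) → Unique es → All (_∉ˢ T) es →
    (Tₑ : Subset (Graph.m G)) → Imposes G cost [] T es Tₑ →
    (kl : Edge G) → kl ∉ˢ T → kl ∉ˢ Tₑ →
    (r₀ r₁ : ℚ∞) → RCost G cost T [] kl r₀ → RCost G cost Tₑ es kl r₁ →
    r₀ ≤∞ r₁
proposition3 G _ _ _ _ _ _ _ _ _ kl _ _ _ _ (noREdge _ p _ p⊆[]) _ =
  ⊥-elim (Graph.noLoop G kl (Walks.edgeless⇒≡ G p p⊆[]))
proposition3 _ _ _ _ _ _ _ _ _ _ _ _ _ _ _ (viaREdge _ _) (noREdge _ _ _ _) = _ ≤∞∞
proposition3 G cost _ _ mst _ _ _ _ imposes kl _ _ _ _ (viaREdge f₀ r₀) (viaREdge f₁ r₁) =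
  fin≤fin (ℚₚ.+-monoʳ-≤ (cost kl) (ℚₚ.neg-antimono-≤ f₁≤f₀))
  where
  f₁≤f₀ : cost f₁ ≤ cost f₀
  f₁≤f₀ = Imposes⇒r-edge-cost-≤ G cost (MinimumSpanningTree.isTree mst) r₀ imposes r₁
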